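{- Let $G$ be a graph without isolated vertices and let $x$ be an inactive vertex of $G$. Then $\operatorname{dist}_G(x,v)\leq 2$ for every $v\in V(G)$; in other words, the eccentricity of $x$ satisfies $ecc_G(x)\in\{1,2\}$.
   Context: A vertex $v$ of $G$ is active if there is a set $W$ of four vertices containing $v$ such that the induced subgraph $\langle W\rangle_G$ is isomorphic to $P_4$, $C_4$ or $2K_2$; otherwise it is inactive. $ecc_G(x)=\max\{\operatorname{dist}_G(v,x): v\in V(G)\}$. -}

module Defs where

open import Data.Nat using (ℕ; zero; suc; _≤_)
open import Data.Fin using (Fin; zero; suc)
open import Data.Product using (Σ; ∃; _×_; _,_)
open import Data.Empty using (⊥)
open import Data.Sum using (_⊎_)
open import Data.Unit using (⊤)
open import Relation.Nullary using (¬_; Dec)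
open import Relation.Binary.PropositionalEquality using (_≡_)
open import Function.Definitions using (Injective)
open import Function.Bundles using (_⇔_)

record Graph (n : ℕ) : Set₁ where
  field
    Adj   : Fin n → Fin n → Set
    adj?  : (u v : Fin n) → Dec (Adj u v)
    sym   : ∀ {u v} → Adj u v → Adj v u
    irrefl : ∀ {u} → ¬ Adj u u
open Graph public

module _ {n : ℕ} (G : Graph n) where

  Isolated : Fin n → Set
  Isolated v = ¬ (∃ λ w → Adj G v w)

  NoIsolatedVertices : Set
  NoIsolatedVertices = ∀ v → ¬ Isolated v

  data Walk : Fin n → Fin n → ℕ → Set where
    here : ∀ {x} → Walk x x 0
    step : ∀ {x y z k} → Adj G x y → Walk y z k → Walk x z (suc k)

  DistLe : Fin n → Fin n → ℕ → Set
  DistLe x y k = Σ ℕ λ m → m ≤ k × Walk x y m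

P4 : Fin 4 → Fin 4 → Set
P4 zero (suc zero) = ⊤
P4 (suc zero) zero = ⊤
P4 (suc zero) (suc (suc zero)) = ⊤
P4 (suc (suc zero)) (suc zero) = ⊤
P4 (suc (suc zero)) (suc (suc (suc zero))) = ⊤
P4 (suc (suc (suc zero))) (suc (suc zero)) = ⊤
P4 _ _ = ⊥

C4 : Fin 4 → Fin 4 → Set
C4 zero (suc (suc (suc zero))) = ⊤
C4 (suc (suc (suc zero))) zero = ⊤
C4 i j = P4 i j

2K2 : Fin 4 → Fin 4 → Set
2K2 zero (suc zero) = ⊤
2K2 (suc zero) zero = ⊤
2K2 (suc (suc zero)) (suc (suc (suc zero))) = ⊤
2K2 (suc (suc (suc zero))) (suc (suc zero)) = ⊤
2K2 _ _ = ⊥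

module _ {n : ℕ} (G : Graph n) where

  InducedCopy : (Fin 4 → Fin 4 → Set) → (Fin 4 → Fin n) → Set
  InducedCopy H f = Injective _≡_ _≡_ f × (∀ i j → Adj G (f i) (f j) ⇔ H i j)

  Active : Fin n → Set
  Active v = Σ (Fin 4 → Fin n) λ f → (∃ λ i → f i ≡ v) ×
               (InducedCopy P4 f ⊎ InducedCopy C4 f ⊎ InducedCopy 2K2 f)

  Inactive : Fin n → Set
  Inactive v = ¬ Active v

-- Let y be a neighbour of x and z a neighbour of a vertex v at distance at
-- least 3 from x. Then x, y, z, v induce the path x–y–z–v when y ~ z, and
-- the matching {xy, vz} otherwise; either way x is active.
module Submission where

open import Defs
open import Data.Nat using (ℕ; z≤n; s≤s)
open import Data.Fin using (Fin; zero; suc)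
open import Data.Fin.Properties using (any?; _≟_)
open import Data.Product using (_×_; ∃; _,_)
open import Data.Sum using (_⊎_; inj₁; inj₂)
open import Data.Unit using (⊤; tt)
open import Data.Empty using (⊥; ⊥-elim)
open import Relation.Nullary using (¬_; Dec; yes; no)
open import Relation.Nullary.Decidable using (_×-dec_; decidable-stable)
open import Relation.Binary.PropositionalEquality using (_≡_; refl; ≢-sym)
  renaming (sym to ≡-sym)
open import Function.Definitions using (Injective)
open import Function.Bundles using (_⇔_; mk⇔)

quadruple : ∀ {n} → Fin n → Fin n → Fin n → Fin n → Fin 4 → Fin n
quadruple a b c d zero                   = a
quadruple a b c d (suc zero)             = b
quadruple a b c d (suc (suc zero))       = c
quadruple a b c d (suc (suc (suc zero))) = d

quadruple-injective : ∀ {n} {a b c d : Fin n} →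
  ¬ a ≡ b → ¬ a ≡ c → ¬ a ≡ d → ¬ b ≡ c → ¬ b ≡ d → ¬ c ≡ d →
  Injective _≡_ _≡_ (quadruple a b c d)
quadruple-injective a≢b a≢c a≢d b≢c b≢d c≢d = injective
  where
  injective : Injective _≡_ _≡_ _
  injective {zero}                   {zero}                   _ = refl
  injective {zero}                   {suc zero}               e = ⊥-elim (a≢b e)
  injective {zero}                   {suc (suc zero)}         e = ⊥-elim (a≢c e)
  injective {zero}                   {suc (suc (suc zero))}   e = ⊥-elim (a≢d e)
  injective {suc zero}               {zero}                   e = ⊥-elim (a≢b (≡-sym e))
  injective {suc zero}               {suc zero}               _ = refl
  injective {suc zero}               {suc (suc zero)}         e = ⊥-elim (b≢c e)
  injective {suc zero}               {suc (suc (suc zero))}   e = ⊥-elim (b≢d e)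
  injective {suc (suc zero)}         {zero}                   e = ⊥-elim (a≢c (≡-sym e))
  injective {suc (suc zero)}         {suc zero}               e = ⊥-elim (b≢c (≡-sym e))
  injective {suc (suc zero)}         {suc (suc zero)}         _ = refl
  injective {suc (suc zero)}         {suc (suc (suc zero))}   e = ⊥-elim (c≢d e)
  injective {suc (suc (suc zero))}   {zero}                   e = ⊥-elim (a≢d (≡-sym e))
  injective {suc (suc (suc zero))}   {suc zero}               e = ⊥-elim (b≢d (≡-sym e))
  injective {suc (suc (suc zero))}   {suc (suc zero)}         e = ⊥-elim (c≢d (≡-sym e))
  injective {suc (suc (suc zero))}   {suc (suc (suc zero))}   _ = refl

module _ {n : ℕ} (G : Graph n) where

  Adj⇒≢ : ∀ {u v} → Adj G u v → ¬ u ≡ v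
  Adj⇒≢ uv refl = irrefl G uv

  Adj⇔⊤ : ∀ {u v} → Adj G u v → Adj G u v ⇔ ⊤
  Adj⇔⊤ uv = mk⇔ (λ _ → tt) (λ _ → uv)

  ¬Adj⇔⊥ : ∀ {u v} → ¬ Adj G u v → Adj G u v ⇔ ⊥
  ¬Adj⇔⊥ ¬uv = mk⇔ ¬uv (λ ())

  ¬Adj-sym : ∀ {u v} → ¬ Adj G u v → ¬ Adj G v u
  ¬Adj-sym ¬uv vu = ¬uv (sym G vu)

  separated⇒≢ : ∀ {u v w} → Adj G u w → ¬ Adj G v w → ¬ u ≡ v
  separated⇒≢ uw ¬vw refl = ¬vw uw

  Far : Fin n → Fin n → Set
  Far x v = ¬ Adj G x v × ¬ (∃ λ w → Adj G x w × Adj G w v)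

  distLe2⊎Far : ∀ x v → DistLe G x v 2 ⊎ Far x v
  distLe2⊎Far x v with x ≟ v
  ... | yes refl = inj₁ (0 , z≤n , here)
  ... | no _ with adj? G x v
  ...   | yes xv = inj₁ (1 , s≤s z≤n , step xv here)
  ...   | no ¬xv with any? (λ w → adj? G x w ×-dec adj? G w v)
  ...     | yes (w , xw , wv) = inj₁ (2 , s≤s (s≤s z≤n) , step xw (step wv here))
  ...     | no ¬common = inj₂ (¬xv , ¬common)

  neighbour : NoIsolatedVertices G → ∀ x → ∃ (Adj G x)
  neighbour noIsolated x = decidable-stable (any? (adj? G x)) (noIsolated x)

  inducedP4 : ∀ {a b c d} → Adj G a b → Adj G b c → Adj G c d →
    ¬ Adj G a c → ¬ Adj G a d → ¬ Adj G b d → InducedCopy G P4 (quadruple a b c d)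
  inducedP4 ab bc cd ¬ac ¬ad ¬bd =
    quadruple-injective (Adj⇒≢ ab) (≢-sym (separated⇒≢ cd ¬ad))
      (separated⇒≢ ab (¬Adj-sym ¬bd)) (Adj⇒≢ bc)
      (separated⇒≢ (sym G ab) (¬Adj-sym ¬ad)) (Adj⇒≢ cd)
    , agree
    where
    agree : ∀ i j → Adj G (quadruple _ _ _ _ i) (quadruple _ _ _ _ j) ⇔ P4 i j
    agree zero                   zero                   = ¬Adj⇔⊥ (irrefl G)
    agree zero                   (suc zero)             = Adj⇔⊤ ab
    agree zero                   (suc (suc zero))       = ¬Adj⇔⊥ ¬ac
    agree zero                   (suc (suc (suc zero))) = ¬Adj⇔⊥ ¬ad
    agree (suc zero)             zero                   = Adj⇔⊤ (sym G ab)
    agree (suc zero)             (suc zero)             = ¬Adj⇔⊥ (irrefl G)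
    agree (suc zero)             (suc (suc zero))       = Adj⇔⊤ bc
    agree (suc zero)             (suc (suc (suc zero))) = ¬Adj⇔⊥ ¬bd
    agree (suc (suc zero))       zero                   = ¬Adj⇔⊥ (¬Adj-sym ¬ac)
    agree (suc (suc zero))       (suc zero)             = Adj⇔⊤ (sym G bc)
    agree (suc (suc zero))       (suc (suc zero))       = ¬Adj⇔⊥ (irrefl G)
    agree (suc (suc zero))       (suc (suc (suc zero))) = Adj⇔⊤ cd
    agree (suc (suc (suc zero))) zero                   = ¬Adj⇔⊥ (¬Adj-sym ¬ad)
    agree (suc (suc (suc zero))) (suc zero)             = ¬Adj⇔⊥ (¬Adj-sym ¬bd)
    agree (suc (suc (suc zero))) (suc (suc zero))       = Adj⇔⊤ (sym G cd)
    agree (suc (suc (suc zero))) (suc (suc (suc zero))) = ¬Adj⇔⊥ (irrefl G)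

  induced2K2 : ∀ {a b c d} → Adj G a b → Adj G c d →
    ¬ Adj G a c → ¬ Adj G a d → ¬ Adj G b c → ¬ Adj G b d →
    InducedCopy G 2K2 (quadruple a b c d)
  induced2K2 ab cd ¬ac ¬ad ¬bc ¬bd =
    quadruple-injective (Adj⇒≢ ab)
      (separated⇒≢ ab (¬Adj-sym ¬bc)) (separated⇒≢ ab (¬Adj-sym ¬bd))
      (separated⇒≢ (sym G ab) (¬Adj-sym ¬ac))
      (separated⇒≢ (sym G ab) (¬Adj-sym ¬ad)) (Adj⇒≢ cd)
    , agree
    where
    agree : ∀ i j → Adj G (quadruple _ _ _ _ i) (quadruple _ _ _ _ j) ⇔ 2K2 i j
    agree zero                   zero                   = ¬Adj⇔⊥ (irrefl G)
    agree zero                   (suc zero)             = Adj⇔⊤ ab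
    agree zero                   (suc (suc zero))       = ¬Adj⇔⊥ ¬ac
    agree zero                   (suc (suc (suc zero))) = ¬Adj⇔⊥ ¬ad
    agree (suc zero)             zero                   = Adj⇔⊤ (sym G ab)
    agree (suc zero)             (suc zero)             = ¬Adj⇔⊥ (irrefl G)
    agree (suc zero)             (suc (suc zero))       = ¬Adj⇔⊥ ¬bc
    agree (suc zero)             (suc (suc (suc zero))) = ¬Adj⇔⊥ ¬bd
    agree (suc (suc zero))       zero                   = ¬Adj⇔⊥ (¬Adj-sym ¬ac)
    agree (suc (suc zero))       (suc zero)             = ¬Adj⇔⊥ (¬Adj-sym ¬bc)
    agree (suc (suc zero))       (suc (suc zero))       = ¬Adj⇔⊥ (irrefl G)
    agree (suc (suc zero))       (suc (suc (suc zero))) = Adj⇔⊤ cd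
    agree (suc (suc (suc zero))) zero                   = ¬Adj⇔⊥ (¬Adj-sym ¬ad)
    agree (suc (suc (suc zero))) (suc zero)             = ¬Adj⇔⊥ (¬Adj-sym ¬bd)
    agree (suc (suc (suc zero))) (suc (suc zero))       = Adj⇔⊤ (sym G cd)
    agree (suc (suc (suc zero))) (suc (suc (suc zero))) = ¬Adj⇔⊥ (irrefl G)

  inactive⇒¬Far : NoIsolatedVertices G → ∀ {x v} → Inactive G x → ¬ Far x v
  inactive⇒¬Far noIsolated {x} {v} inactive (¬xv , ¬common)
    with neighbour noIsolated x | neighbour noIsolated v
  ... | y , xy | z , vz = copy (adj? G y z)
    where
    ¬xz : ¬ Adj G x z
    ¬xz xz = ¬common (z , xz , sym G vz)
    ¬yv : ¬ Adj G y v
    ¬yv yv = ¬common (y , xy , yv)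
    copy : Dec (Adj G y z) → ⊥
    copy (yes yz) = inactive (quadruple x y z v , (zero , refl) ,
                      inj₁ (inducedP4 xy yz (sym G vz) ¬xz ¬xv ¬yv))
    copy (no ¬yz) = inactive (quadruple x y v z , (zero , refl) ,
                      inj₂ (inj₂ (induced2K2 xy vz ¬xv ¬xz ¬yv ¬yz)))

mainTheorem13 : {n : ℕ} (G : Graph n) → NoIsolatedVertices G → (x : Fin n) → Inactive G x →
    (∀ v → DistLe G x v 2) × (∃ λ v → ¬ v ≡ x)
mainTheorem13 G noIsolated x inactive = within2 , other
  where
  within2 : ∀ v → DistLe G x v 2
  within2 v with distLe2⊎Far G x v
  ... | inj₁ close = close
  ... | inj₂ far   = ⊥-elim (inactive⇒¬Far G noIsolated inactive far)
  other : ∃ λ v → ¬ v ≡ x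
  other with neighbour G noIsolated x
  ... | y , xy = y , ≢-sym (Adj⇒≢ G xy)
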